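{- Let $d\geq 2$. For each $\ell\geq 0$ there is a first-order formula $\mathrm{coreach}_{d,\ell}(x,y,x',y')$ over $\tau_{d-1}$ such that for every $\mathcal{F}\in\mathfrak{F}_d$ and all nodes $a,b,a',b'$ of $\mathcal{F}$: $\mathcal{F}\models\mathrm{coreach}_{d,\ell}[a,b,a',b']$ if and only if $b,b'$ are co-reachable from $a,a'$ with distance $\leq\ell$. The size of $\mathrm{coreach}_{d,\ell}$ is $O(d\cdot\log\ell)$ for $\ell\geq2$.
   Context: $\tau_{d-1}:=\{E_1,\dots,E_{d-1},L\}$ with binary $E_i$ and unary $L$. $\mathfrak{F}_d$ is the class of finite $\tau_{d-1}$-structures that are labeled ordered forests of arity $d-1$: disjoint unions of rooted trees in which every node has at most $d-1$ children, $(u,v)\in E_i$ iff $v$ is the $i$-th child of $u$, and $L$ is an arbitrary label set. Nodes $b,b'$ are co-reachable from $a,a'$ with distance $\leq\ell$ if there are $n\leq\ell$ and sequences $a=c_0,\dots,c_n=b$ and $a'=c'_0,\dots,c'_n=b'$ of nodes such that for every $i\in[0,n-1]$ there is $j\in[d-1]$ with $(c_i,c_{i+1})\in E_j$ and $(c'_i,c'_{i+1})\in E_j$. The size of a formula is its length as a word. -}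

module Defs where

open import Data.Nat using (ℕ; zero; suc; _+_; _*_; _∸_; _≤_; _≟_)
open import Data.Fin using (Fin; fromℕ; inject₁) renaming (suc to fsuc; zero to fzero)
open import Data.Bool using (Bool; true)
open import Data.Product using (Σ; ∃; _×_; _,_)
open import Data.Sum using (_⊎_)
open import Data.Empty using (⊥)
open import Relation.Nullary using (¬_; yes; no)
open import Relation.Binary.PropositionalEquality using (_≡_)

-- Vocabulary τ_{m} = {E_1,…,E_m, L}: binary relations indexed by Fin m, one unary L.
-- A finite τ_m-structure with universe Fin n.
record Structure (m : ℕ) : Set where
  field
    size : ℕ
    E    : Fin m → Fin size → Fin size → Bool
    L    : Fin size → Bool
open Structure public

Node : ∀ {m} → Structure m → Set
Node 𝓕 = Fin (size 𝓕)

Edge : ∀ {m} (𝓕 : Structure m) → Fin m → Node 𝓕 → Node 𝓕 → Set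
Edge 𝓕 i u v = E 𝓕 i u v ≡ true

AnyEdge : ∀ {m} (𝓕 : Structure m) → Node 𝓕 → Node 𝓕 → Set
AnyEdge 𝓕 u v = ∃ λ i → Edge 𝓕 i u v

data Desc {m} (𝓕 : Structure m) : Node 𝓕 → Node 𝓕 → Set where
  step  : ∀ {u v} → AnyEdge 𝓕 u v → Desc 𝓕 u v
  _then_ : ∀ {u v w} → AnyEdge 𝓕 u v → Desc 𝓕 v w → Desc 𝓕 u w

-- Equivalently: a disjoint union of rooted trees,
-- every node having at most m children, (u,v) ∈ E_i iff v is the i-th child of u;
-- L is arbitrary.
record IsOrderedForest {m} (𝓕 : Structure m) : Set where
  field
    child-unique  : ∀ i u v v' → Edge 𝓕 i u v → Edge 𝓕 i u v' → v ≡ v'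
    parent-unique : ∀ i j u u' v → Edge 𝓕 i u v → Edge 𝓕 j u' v → (u ≡ u') × (i ≡ j)
    acyclic       : ∀ v → ¬ Desc 𝓕 v v

𝔉 : ℕ → Set
𝔉 d = Σ (Structure (d ∸ 1)) IsOrderedForest

CoReachable : ∀ {m} (𝓕 : Structure m) → ℕ → (a b a' b' : Node 𝓕) → Set
CoReachable 𝓕 ℓ a b a' b' =
  Σ ℕ λ n → n ≤ ℓ × Σ (Fin (suc n) → Node 𝓕) λ c → Σ (Fin (suc n) → Node 𝓕) λ c' →
    (c fzero ≡ a) × (c (fromℕ n) ≡ b) × (c' fzero ≡ a') × (c' (fromℕ n) ≡ b') ×
    (∀ (i : Fin n) → ∃ λ j → Edge 𝓕 j (c (inject₁ i)) (c (fsuc i))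
                           × Edge 𝓕 j (c' (inject₁ i)) (c' (fsuc i)))

Var : Set
Var = ℕ

data Formula (m : ℕ) : Set where
  eq   : Var → Var → Formula m
  rel  : Fin m → Var → Var → Formula m
  lab  : Var → Formula m
  neg  : Formula m → Formula m
  conj : Formula m → Formula m → Formula m
  disj : Formula m → Formula m → Formula m
  ex   : Var → Formula m → Formula m
  all  : Var → Formula m → Formula m

Assignment : ∀ {m} → Structure m → Set
Assignment 𝓕 = Var → Node 𝓕

update : ∀ {m} {𝓕 : Structure m} → Assignment 𝓕 → Var → Node 𝓕 → Assignment 𝓕
update ρ x a y with x ≟ y
... | yes _ = a
... | no  _ = ρ y

Sat : ∀ {m} (𝓕 : Structure m) → Formula m → Assignment 𝓕 → Set
Sat 𝓕 (eq x y)     ρ = ρ x ≡ ρ y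
Sat 𝓕 (rel i x y)  ρ = Edge 𝓕 i (ρ x) (ρ y)
Sat 𝓕 (lab x)      ρ = L 𝓕 (ρ x) ≡ true
Sat 𝓕 (neg φ)      ρ = ¬ Sat 𝓕 φ ρ
Sat 𝓕 (conj φ ψ)   ρ = Sat 𝓕 φ ρ × Sat 𝓕 ψ ρ
Sat 𝓕 (disj φ ψ)   ρ = Sat 𝓕 φ ρ ⊎ Sat 𝓕 ψ ρ
Sat 𝓕 (ex x φ)     ρ = Σ (Node 𝓕) λ a → Sat 𝓕 φ (update {𝓕 = 𝓕} ρ x a)
Sat 𝓕 (all x φ)    ρ = ∀ (a : Node 𝓕) → Sat 𝓕 φ (update {𝓕 = 𝓕} ρ x a)

-- Length of the formula as a word (each variable / relation symbol is one letter):
--   x = y : 3,  E_i(x,y) : 6,  L(x) : 4,  ¬φ : 1+|φ|,  (φ∧ψ),(φ∨ψ) : 3+|φ|+|ψ|,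
--   ∃xφ, ∀xφ : 2+|φ|
formulaSize : ∀ {m} → Formula m → ℕ
formulaSize (eq _ _)    = 3
formulaSize (rel _ _ _) = 6
formulaSize (lab _)     = 4
formulaSize (neg φ)     = 1 + formulaSize φ
formulaSize (conj φ ψ)  = 3 + formulaSize φ + formulaSize ψ
formulaSize (disj φ ψ)  = 3 + formulaSize φ + formulaSize ψ
formulaSize (ex _ φ)    = 2 + formulaSize φ
formulaSize (all _ φ)   = 2 + formulaSize φ

module Submission where

-- Writing ℓ in binary, ℓ = bit b + 2k, a synchronous pair of walks of length ≤ ℓ
-- from (a, a') to (b, b') splits into a first half of length ≤ k ending in some
-- pair (z, z'), a middle part of length ≤ bit b from (z, z') to (w, w'), and a
-- second half of length ≤ k.  The two halves are expressed by ONE recursive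
-- occurrence of the formula for k: after copying x, y, x', y' into fresh variables
-- and guessing z, z', w, w', the formula quantifies over all tuples (x, y, x', y')
-- and, guarded by "this tuple is (x, z, x', z') or (w, y, w', y')", asserts the
-- formula for k.  Each binary digit thus costs O(d) symbols (the middle step is a
-- disjunction over the d - 1 edge colours), giving size O(d · log ℓ).

open import Defs
open import Data.Nat using (ℕ; zero; suc; _+_; _*_; _∸_; _≤_; _<_; z≤n; s≤s; ⌊_/2⌋)
open import Data.Nat.Properties
open import Data.Nat.Induction using (<-rec)
open import Data.Nat.Logarithm using (⌊log₂_⌋; ⌊log₂⌊n/2⌋⌋≡⌊log₂n⌋∸1; ⌊log₂⌋-mono-≤)
open import Data.Nat.Tactic.RingSolver using (solve-∀)
open import Data.Fin using (Fin; fromℕ; inject₁) renaming (suc to fsuc; zero to fzero; _≟_ to _≟F_)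
open import Data.Bool using (Bool; true; false)
open import Data.List using (List; []; _∷_; length)
open import Data.Product using (Σ; ∃; _×_; _,_; proj₁; proj₂)
open import Data.Sum using (_⊎_; inj₁; inj₂)
open import Data.Empty using (⊥-elim)
open import Relation.Nullary using (yes; no)
open import Relation.Nullary.Decidable using (_×-dec_; _⊎-dec_)
open import Relation.Binary.PropositionalEquality
  using (_≡_; refl; sym; trans; cong; subst; module ≡-Reasoning)
open import Function.Bundles using (_⇔_; mk⇔; Equivalence)
open import Function.Construct.Symmetry using (⇔-sym)
open import Function.Construct.Composition using (_⇔-∘_)

open Equivalence using (to; from)

bit : Bool → ℕ
bit false = 0
bit true  = 1

value : List Bool → ℕ
value []       = 0
value (b ∷ bs) = bit b + (value bs + value bs)

parity : ∀ n → Σ Bool λ b → n ≡ bit b + (⌊ n /2⌋ + ⌊ n /2⌋)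
parity zero          = false , refl
parity (suc zero)    = true , refl
parity (suc (suc n)) with parity n
... | b , n≡ = b , (begin
  suc (suc n)                                  ≡⟨ cong (λ x → suc (suc x)) n≡ ⟩
  suc (suc (bit b + (⌊ n /2⌋ + ⌊ n /2⌋)))      ≡⟨ shift (bit b) ⌊ n /2⌋ ⟩
  bit b + (suc ⌊ n /2⌋ + suc ⌊ n /2⌋)          ∎)
  where
  open ≡-Reasoning
  shift : ∀ x h → suc (suc (x + (h + h))) ≡ x + (suc h + suc h)
  shift = solve-∀

log-half : ∀ n → 2 ≤ n → suc ⌊log₂ ⌊ n /2⌋ ⌋ ≡ ⌊log₂ n ⌋
log-half n 2≤n = begin
  suc ⌊log₂ ⌊ n /2⌋ ⌋    ≡⟨ cong suc (⌊log₂⌊n/2⌋⌋≡⌊log₂n⌋∸1 n) ⟩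
  suc (⌊log₂ n ⌋ ∸ 1)    ≡⟨ m+[n∸m]≡n (⌊log₂⌋-mono-≤ {2} 2≤n) ⟩
  ⌊log₂ n ⌋              ∎
  where open ≡-Reasoning

BinaryExpansion : ℕ → Set
BinaryExpansion ℓ = Σ (List Bool) λ bs → value bs ≡ ℓ × length bs ≤ suc ⌊log₂ ℓ ⌋

binary : ∀ ℓ → BinaryExpansion ℓ
binary = <-rec BinaryExpansion expand
  where
  expand : ∀ ℓ → (∀ {k} → k < ℓ → BinaryExpansion k) → BinaryExpansion ℓ
  expand zero          _   = [] , refl , z≤n
  expand (suc zero)    _   = true ∷ [] , refl , s≤s z≤n
  expand (suc (suc n)) rec with parity (suc (suc n)) | rec (⌊n/2⌋<n (suc n))
  ... | b , ℓ≡ | bs , v≡ , len =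
    b ∷ bs ,
    trans (cong (λ x → bit b + (x + x)) v≡) (sym ℓ≡) ,
    s≤s (≤-trans len (≤-reflexive (log-half (suc (suc n)) (s≤s (s≤s z≤n)))))

module Paths {m : ℕ} (𝓕 : Structure m) where

  N : Set
  N = Node 𝓕

  CommonEdge : N → N → N → N → Set
  CommonEdge z w z' w' = ∃ λ j → Edge 𝓕 j z w × Edge 𝓕 j z' w'

  data Path : ℕ → N → N → N → N → Set where
    nil  : ∀ {a a'} → Path 0 a a a' a'
    cons : ∀ {n a c b a' c' b'} →
           CommonEdge a c a' c' → Path n c b c' b' → Path (suc n) a b a' b'

  Within : ℕ → N → N → N → N → Set
  Within ℓ a b a' b' = Σ ℕ λ n → n ≤ ℓ × Path n a b a' b'

  _++ᵖ_ : ∀ {n k a z b a' z' b'} → Path n a z a' z' → Path k z b z' b' →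
          Path (n + k) a b a' b'
  nil        ++ᵖ q = q
  cons e p   ++ᵖ q = cons e (p ++ᵖ q)

  splitPath : ∀ k {n a b a' b'} → k ≤ n → Path n a b a' b' →
              Σ N λ z → Σ N λ z' → Path k a z a' z' × Path (n ∸ k) z b z' b'
  splitPath zero    _         p          = _ , _ , nil , p
  splitPath (suc k) (s≤s k≤n) (cons e p) with splitPath k k≤n p
  ... | z , z' , p₁ , p₂ = z , z' , cons e p₁ , p₂

  within-++ : ∀ {k k' a z b a' z' b'} → Within k a z a' z' → Within k' z b z' b' →
              Within (k + k') a b a' b'
  within-++ (n , n≤k , p) (n' , n'≤k' , p') = n + n' , +-mono-≤ n≤k n'≤k' , p ++ᵖ p'

  within-split : ∀ k k' {a b a' b'} → Within (k + k') a b a' b' →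
                 Σ N λ z → Σ N λ z' → Within k a z a' z' × Within k' z b z' b'
  within-split k k' (n , n≤ , p) with n ≤? k
  ... | yes n≤k = _ , _ , (n , n≤k , p) , (0 , z≤n , nil)
  ... | no  n≰k with splitPath k (≰⇒≥ n≰k) p
  ...   | z , z' , p₁ , p₂ = z , z' , (k , ≤-refl , p₁) , (n ∸ k , m≤n+o⇒m∸n≤o n k n≤ , p₂)

  Halves : Bool → ℕ → N → N → N → N → Set
  Halves b k a c a' c' = Σ N λ z → Σ N λ z' → Σ N λ w → Σ N λ w' →
    Within k a z a' z' × Within (bit b) z w z' w' × Within k w c w' c'

  within-halve : ∀ b k {a c a' c'} → Within (bit b + (k + k)) a c a' c' ⇔ Halves b k a c a' c'
  within-halve b k {a} {c} {a'} {c'} = mk⇔ decompose compose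
    where
    reorder : k + (bit b + k) ≡ bit b + (k + k)
    reorder = swap (bit b) k
      where
      swap : ∀ x y → y + (x + y) ≡ x + (y + y)
      swap = solve-∀
    decompose : Within (bit b + (k + k)) a c a' c' → Halves b k a c a' c'
    decompose p with within-split k (bit b + k) (subst (λ ℓ → Within ℓ a c a' c') (sym reorder) p)
    ... | z , z' , first , rest with within-split (bit b) k rest
    ...   | w , w' , middle , second = z , z' , w , w' , first , middle , second
    compose : Halves b k a c a' c' → Within (bit b + (k + k)) a c a' c'
    compose (z , z' , w , w' , first , middle , second) =
      subst (λ ℓ → Within ℓ a c a' c') reorder (within-++ first (within-++ middle second))

  Same : N → N → N → N → Set
  Same z w z' w' = z ≡ w × z' ≡ w'

  within-0 : ∀ {z w z' w'} → Within 0 z w z' w' ⇔ Same z w z' w'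
  within-0 = mk⇔ (λ { (0 , _ , nil) → refl , refl }) (λ { (refl , refl) → 0 , z≤n , nil })

  within-1 : ∀ {z w z' w'} → Within 1 z w z' w' ⇔ (Same z w z' w' ⊎ CommonEdge z w z' w')
  within-1 = mk⇔ one (λ { (inj₁ (refl , refl)) → 0 , z≤n , nil ; (inj₂ e) → 1 , ≤-refl , cons e nil })
    where
    one : ∀ {z w z' w'} → Within 1 z w z' w' → Same z w z' w' ⊎ CommonEdge z w z' w'
    one (0 , _ , nil)              = inj₁ (refl , refl)
    one (1 , _ , cons e nil)       = inj₂ e
    one (suc (suc _) , s≤s () , _)

  Walks : ∀ n → (Fin (suc n) → N) → (Fin (suc n) → N) → Set
  Walks n c c' = ∀ (i : Fin n) →
    CommonEdge (c (inject₁ i)) (c (fsuc i)) (c' (inject₁ i)) (c' (fsuc i))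

  walksToPath : ∀ n (c c' : Fin (suc n) → N) → Walks n c c' →
                Path n (c fzero) (c (fromℕ n)) (c' fzero) (c' (fromℕ n))
  walksToPath zero    c c' ws = nil
  walksToPath (suc n) c c' ws =
    cons (ws fzero) (walksToPath n (λ i → c (fsuc i)) (λ i → c' (fsuc i)) (λ i → ws (fsuc i)))

  pathToWalks : ∀ {n a b a' b'} → Path n a b a' b' →
    Σ (Fin (suc n) → N) λ c → Σ (Fin (suc n) → N) λ c' →
      (c fzero ≡ a) × (c (fromℕ n) ≡ b) × (c' fzero ≡ a') × (c' (fromℕ n) ≡ b') × Walks n c c'
  pathToWalks {a = a} {a' = a'} nil = (λ _ → a) , (λ _ → a') , refl , refl , refl , refl , λ ()
  pathToWalks {a = a} {a' = a'} (cons e p) with pathToWalks p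
  ... | c , c' , refl , c-end , refl , c'-end , ws =
    prepend a c , prepend a' c' , refl , c-end , refl , c'-end , ws′
    where
    prepend : ∀ {n} → N → (Fin (suc n) → N) → Fin (suc (suc n)) → N
    prepend x c fzero    = x
    prepend x c (fsuc i) = c i
    ws′ : Walks _ (prepend a c) (prepend a' c')
    ws′ fzero    = e
    ws′ (fsuc i) = ws i

  coreachable⇔within : ∀ ℓ {a b a' b'} → CoReachable 𝓕 ℓ a b a' b' ⇔ Within ℓ a b a' b'
  coreachable⇔within ℓ = mk⇔
    (λ { (n , n≤ℓ , c , c' , refl , refl , refl , refl , ws) → n , n≤ℓ , walksToPath n c c' ws })
    (λ { (n , n≤ℓ , p) → n , n≤ℓ , pathToWalks p })

-- The formulas.  Free variables: x = 0, y = 1, x' = 2, y' = 3.  In the recursive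
-- step, 4–7 save x, y, x', y', and (8, 9), (10, 11) hold the midpoint pairs
-- (z, z'), (w, w').

module Formulas {m : ℕ} where

  stayOrEdge : (k : ℕ) → (Fin k → Fin m) → Var → Var → Var → Var → Formula m
  stayOrEdge zero    f u v u' v' = conj (eq u v) (eq u' v')
  stayOrEdge (suc k) f u v u' v' =
    disj (conj (rel (f fzero) u v) (rel (f fzero) u' v')) (stayOrEdge k (λ i → f (fsuc i)) u v u' v')

  bitStep : Bool → Var → Var → Var → Var → Formula m
  bitStep false u v u' v' = conj (eq u v) (eq u' v')
  bitStep true            = stayOrEdge m (λ i → i)

  saveFree : Formula m
  saveFree = conj (eq 4 0) (conj (eq 5 1) (conj (eq 6 2) (eq 7 3)))

  isHalf : Formula m
  isHalf = disj (conj (eq 0 4) (conj (eq 1 8) (conj (eq 2 6) (eq 3 9))))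
                (conj (eq 0 10) (conj (eq 1 5) (conj (eq 2 11) (eq 3 7))))

  -- ∀ x y x' y' (isHalf → ψ): a single occurrence of ψ used for both halves
  bothHalves : Formula m → Formula m
  bothHalves ψ = all 0 (all 1 (all 2 (all 3 (disj (neg isHalf) ψ))))

  coreach : List Bool → Formula m
  coreach []       = conj (eq 0 1) (eq 2 3)
  coreach (b ∷ bs) = ex 4 (ex 5 (ex 6 (ex 7 (ex 8 (ex 9 (ex 10 (ex 11
    (conj saveFree (conj (bitStep b 8 10 9 11) (bothHalves (coreach bs)))))))))))

open Formulas

module Semantics {m : ℕ} (𝓕 : Structure m) where
  open Paths 𝓕

  stayOrEdge-sat : ∀ k (f : Fin k → Fin m) u v u' v' ρ →
    Sat 𝓕 (stayOrEdge k f u v u' v') ρ ⇔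
    (Same (ρ u) (ρ v) (ρ u') (ρ v') ⊎
     Σ (Fin k) λ i → Edge 𝓕 (f i) (ρ u) (ρ v) × Edge 𝓕 (f i) (ρ u') (ρ v'))
  stayOrEdge-sat k f u v u' v' ρ = mk⇔ (sound k f) (complete k f)
    where
    Colours : ∀ k → (Fin k → Fin m) → Set
    Colours k f = Same (ρ u) (ρ v) (ρ u') (ρ v') ⊎
                  Σ (Fin k) λ i → Edge 𝓕 (f i) (ρ u) (ρ v) × Edge 𝓕 (f i) (ρ u') (ρ v')
    sound : ∀ k f → Sat 𝓕 (stayOrEdge k f u v u' v') ρ → Colours k f
    sound zero    f same          = inj₁ same
    sound (suc k) f (inj₁ edges)  = inj₂ (fzero , edges)
    sound (suc k) f (inj₂ rest) with sound k (λ i → f (fsuc i)) rest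
    ... | inj₁ same           = inj₁ same
    ... | inj₂ (i , edges)    = inj₂ (fsuc i , edges)
    complete : ∀ k f → Colours k f → Sat 𝓕 (stayOrEdge k f u v u' v') ρ
    complete zero    f (inj₁ same)             = same
    complete (suc k) f (inj₁ same)             = inj₂ (complete k _ (inj₁ same))
    complete (suc k) f (inj₂ (fzero , edges))  = inj₁ edges
    complete (suc k) f (inj₂ (fsuc i , edges)) = inj₂ (complete k _ (inj₂ (i , edges)))

  bitStep-sat : ∀ b u v u' v' ρ →
    Sat 𝓕 (bitStep b u v u' v') ρ ⇔ Within (bit b) (ρ u) (ρ v) (ρ u') (ρ v')
  bitStep-sat false u v u' v' ρ = ⇔-sym within-0
  bitStep-sat true  u v u' v' ρ = ⇔-sym within-1 ⇔-∘ stayOrEdge-sat m (λ i → i) u v u' v' ρ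

  bothHalves-sat : ∀ ψ (P : N → N → N → N → Set) →
    (∀ σ → Sat 𝓕 ψ σ ⇔ P (σ 0) (σ 1) (σ 2) (σ 3)) →
    ∀ ρ → Sat 𝓕 (bothHalves ψ) ρ ⇔ (P (ρ 4) (ρ 8) (ρ 6) (ρ 9) × P (ρ 10) (ρ 5) (ρ 11) (ρ 7))
  bothHalves-sat ψ P ψ⇔P ρ = mk⇔ instantiate generalise
    where
    instantiate : Sat 𝓕 (bothHalves ψ) ρ → P (ρ 4) (ρ 8) (ρ 6) (ρ 9) × P (ρ 10) (ρ 5) (ρ 11) (ρ 7)
    instantiate h = first (h (ρ 4) (ρ 8) (ρ 6) (ρ 9)) , second (h (ρ 10) (ρ 5) (ρ 11) (ρ 7))
      where
      first : _ ⊎ _ → P (ρ 4) (ρ 8) (ρ 6) (ρ 9)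
      first (inj₁ notHalf) = ⊥-elim (notHalf (inj₁ (refl , refl , refl , refl)))
      first (inj₂ sat)     = to (ψ⇔P _) sat
      second : _ ⊎ _ → P (ρ 10) (ρ 5) (ρ 11) (ρ 7)
      second (inj₁ notHalf) = ⊥-elim (notHalf (inj₂ (refl , refl , refl , refl)))
      second (inj₂ sat)     = to (ψ⇔P _) sat
    generalise : P (ρ 4) (ρ 8) (ρ 6) (ρ 9) × P (ρ 10) (ρ 5) (ρ 11) (ρ 7) → Sat 𝓕 (bothHalves ψ) ρ
    generalise (p₁ , p₂) u₀ u₁ u₂ u₃
      with ((u₀ ≟F ρ 4) ×-dec (u₁ ≟F ρ 8) ×-dec (u₂ ≟F ρ 6) ×-dec (u₃ ≟F ρ 9))
      ⊎-dec ((u₀ ≟F ρ 10) ×-dec (u₁ ≟F ρ 5) ×-dec (u₂ ≟F ρ 11) ×-dec (u₃ ≟F ρ 7))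
    ... | no notHalf                              = inj₁ notHalf
    ... | yes (inj₁ (refl , refl , refl , refl)) = inj₂ (from (ψ⇔P _) p₁)
    ... | yes (inj₂ (refl , refl , refl , refl)) = inj₂ (from (ψ⇔P _) p₂)

  coreach-sat : ∀ bs ρ → Sat 𝓕 (coreach bs) ρ ⇔ Within (value bs) (ρ 0) (ρ 1) (ρ 2) (ρ 3)
  coreach-sat []       ρ = ⇔-sym within-0
  coreach-sat (b ∷ bs) ρ = mk⇔ sound complete
    where
    halves : ∀ σ → Sat 𝓕 (bothHalves (coreach bs)) σ ⇔
      (Within (value bs) (σ 4) (σ 8) (σ 6) (σ 9) × Within (value bs) (σ 10) (σ 5) (σ 11) (σ 7))
    halves = bothHalves-sat (coreach bs) (Within (value bs)) (coreach-sat bs)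
    extend : N → N → N → N → N → N → N → N → Assignment 𝓕
    extend x₄ x₅ x₆ x₇ z z' w w' =
      update (update (update (update (update (update (update (update ρ
        4 x₄) 5 x₅) 6 x₆) 7 x₇) 8 z) 9 z') 10 w) 11 w'
    sound : Sat 𝓕 (coreach (b ∷ bs)) ρ → Within (value (b ∷ bs)) (ρ 0) (ρ 1) (ρ 2) (ρ 3)
    sound (_ , _ , _ , _ , z , z' , w , w' , (refl , refl , refl , refl) , middle , both) =
      from (within-halve b (value bs))
        (z , z' , w , w' , proj₁ halvesHold , to (bitStep-sat b 8 10 9 11 σ) middle , proj₂ halvesHold)
      where
      σ : Assignment 𝓕
      σ = extend (ρ 0) (ρ 1) (ρ 2) (ρ 3) z z' w w'
      halvesHold : Within (value bs) (ρ 0) z (ρ 2) z' × Within (value bs) w (ρ 1) w' (ρ 3)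
      halvesHold = to (halves σ) both
    complete : Within (value (b ∷ bs)) (ρ 0) (ρ 1) (ρ 2) (ρ 3) → Sat 𝓕 (coreach (b ∷ bs)) ρ
    complete p = build (to (within-halve b (value bs)) p)
      where
      build : Halves b (value bs) (ρ 0) (ρ 1) (ρ 2) (ρ 3) → Sat 𝓕 (coreach (b ∷ bs)) ρ
      build (z , z' , w , w' , first , middle , second) =
        ρ 0 , ρ 1 , ρ 2 , ρ 3 , z , z' , w , w' , (refl , refl , refl , refl) ,
        from (bitStep-sat b 8 10 9 11 σ) middle , from (halves σ) (first , second)
        where
        σ : Assignment 𝓕
        σ = extend (ρ 0) (ρ 1) (ρ 2) (ρ 3) z z' w w'

-- Sizes: each binary digit costs 109 + 18·m symbols (m = d - 1 colours)
stayOrEdge-size : ∀ {m} k (f : Fin k → Fin m) u v u' v' →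
  formulaSize (stayOrEdge k f u v u' v') ≡ 9 + 18 * k
stayOrEdge-size zero    f u v u' v' = refl
stayOrEdge-size (suc k) f u v u' v' =
  trans (cong (18 +_) (stayOrEdge-size k _ u v u' v')) (grow k)
  where
  grow : ∀ k → 18 + (9 + 18 * k) ≡ 9 + 18 * suc k
  grow = solve-∀

bitStep-size : ∀ {m} b u v u' v' → formulaSize (bitStep {m} b u v u' v') ≤ 9 + 18 * m
bitStep-size     false u v u' v' = m≤m+n 9 _
bitStep-size {m}     true  u v u' v' = ≤-reflexive (stayOrEdge-size m _ u v u' v')

coreach-size : ∀ {m} bs → formulaSize (coreach {m} bs) ≤ 9 + length bs * (109 + 18 * m)
coreach-size []           = ≤-refl
coreach-size {m} (b ∷ bs) = begin
  formulaSize (coreach {m} (b ∷ bs))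
    ≤⟨ +-monoʳ-≤ 43 (+-mono-≤ (bitStep-size b 8 10 9 11) (+-monoʳ-≤ 57 (coreach-size bs))) ⟩
  43 + ((9 + 18 * m) + (57 + (9 + length bs * (109 + 18 * m))))
    ≡⟨ collect m (length bs) ⟩
  9 + suc (length bs) * (109 + 18 * m) ∎
  where
  open ≤-Reasoning
  collect : ∀ m n → 43 + ((9 + 18 * m) + (57 + (9 + n * (109 + 18 * m))))
                    ≡ 9 + suc n * (109 + 18 * m)
  collect = solve-∀

digits-bound : ∀ m L n → 1 ≤ L → n ≤ suc L → 9 + n * (109 + 18 * m) ≤ 227 * suc m * L
digits-bound m L n 1≤L n≤1+L = begin
  9 + n * K
    ≤⟨ +-mono-≤ (*-monoʳ-≤ 9 1≤L) (*-monoˡ-≤ K (≤-trans n≤1+L (+-monoˡ-≤ L 1≤L))) ⟩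
  9 * L + (L + L) * K
    ≡⟨ regroup L m ⟩
  (227 + 36 * m) * L
    ≤⟨ *-monoˡ-≤ L (+-monoʳ-≤ 227 (*-monoˡ-≤ m (m≤m+n 36 191))) ⟩
  (227 + 227 * m) * L
    ≡⟨ cong (_* L) (sym (*-suc 227 m)) ⟩
  227 * suc m * L ∎
  where
  open ≤-Reasoning
  K : ℕ
  K = 109 + 18 * m
  regroup : ∀ L m → 9 * L + (L + L) * (109 + 18 * m) ≡ (227 + 36 * m) * L
  regroup = solve-∀

lemma16 : Σ ℕ λ C → ∀ (d : ℕ) → 2 ≤ d → ∀ (ℓ : ℕ) →
    Σ (Formula (d ∸ 1)) λ φ →
      (∀ (𝓕 : 𝔉 d) (ρ : Assignment (proj₁ 𝓕)) →
        Sat (proj₁ 𝓕) φ ρ ⇔ CoReachable (proj₁ 𝓕) ℓ (ρ 0) (ρ 1) (ρ 2) (ρ 3))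
      × (2 ≤ ℓ → formulaSize φ ≤ C * d * ⌊log₂ ℓ ⌋)
lemma16 = 227 , formula
  where
  formula : ∀ (d : ℕ) → 2 ≤ d → ∀ (ℓ : ℕ) →
    Σ (Formula (d ∸ 1)) λ φ →
      (∀ (𝓕 : 𝔉 d) (ρ : Assignment (proj₁ 𝓕)) →
        Sat (proj₁ 𝓕) φ ρ ⇔ CoReachable (proj₁ 𝓕) ℓ (ρ 0) (ρ 1) (ρ 2) (ρ 3))
      × (2 ≤ ℓ → formulaSize φ ≤ 227 * d * ⌊log₂ ℓ ⌋)
  formula (suc zero)    (s≤s ()) ℓ
  formula (suc (suc m)) _        ℓ with binary ℓ
  ... | bs , refl , length≤ = coreach bs , correct , small
    where
    correct : ∀ (𝓕 : 𝔉 (suc (suc m))) ρ →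
      Sat (proj₁ 𝓕) (coreach bs) ρ ⇔ CoReachable (proj₁ 𝓕) (value bs) (ρ 0) (ρ 1) (ρ 2) (ρ 3)
    correct (F , _) ρ = ⇔-sym (Paths.coreachable⇔within F (value bs)) ⇔-∘ Semantics.coreach-sat F bs ρ
    small : 2 ≤ value bs → formulaSize (coreach {suc m} bs) ≤ 227 * suc (suc m) * ⌊log₂ value bs ⌋
    small 2≤ℓ = ≤-trans (coreach-size bs)
      (digits-bound (suc m) ⌊log₂ value bs ⌋ (length bs) (⌊log₂⌋-mono-≤ {2} 2≤ℓ) length≤)
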